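{- Assume one of the following four settings: (i) $\mathfrak{D}'=\mathfrak{D}$ and $R\in\mathfrak{D}$; (ii) $\mathfrak{T}_a\subseteq\mathfrak{D}'\subseteq\mathfrak{D}$ and $R\in\mathfrak{T}_a$; (iii) $\mathfrak{D}'=\mathfrak{P}$ and $R\in\mathfrak{P}$; (iv) $\mathfrak{D}'=\mathfrak{P}^*$ and $R\in\mathfrak{P}^*$. Let $S\in\mathfrak{D}$, and let $\rho$ be an S-scheme from $R$ to $S$ with respect to $\mathfrak{D}'$ such that, for all $G,H\in\mathfrak{D}'$, $\xi\in\mathcal{S}(G,R)$, $\zeta\in\mathcal{S}(H,R)$, $v\in V(G)$, $w\in V(H)$, $$\alpha^R_{G,\xi}(v)=\alpha^R_{H,\zeta}(w)\Rightarrow\alpha^S_{G,\rho_G(\xi)}(v)=\alpha^S_{H,\rho_H(\zeta)}(w).$$ Put $\epsilon:=\alpha^S_{\mathcal{E}(R),\rho_{\mathcal{E}(R)}(\phi_R)}$, and let $\mathfrak{a}\in\mathcal{E}_o(R)$. If $\rho$ is strong, then: - for every $\pi\in\mathrm{Aut}(X(\mathfrak{a}))$, the map $\rho_{X(\mathfrak{a})}(\iota(\mathfrak{a})\circ\pi)$ is one-to-one on $D$ and one-to-one on $U$; - $X(\mathfrak{a})\simeq X(\epsilon(\mathfrak{a}))$.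
   Context: Digraphs $G=(V(G),A(G))$ have a finite nonempty vertex set, and $A(G)\subseteq V(G)\times V(G)$; loops are allowed. $G^*$ is $G$ with loops removed. $N^{in}_G(v)=\{w\ne v:wv\in A(G)\}$ and $N^{out}_G(v)=\{w\ne v:vw\in A(G)\}$. A homomorphism maps arcs to arcs; it is strict if, in addition, it maps proper arcs to proper arcs. $\mathcal{S}(G,H)$ is the set of strict homomorphisms. Classes of digraphs: - $\mathfrak{D}$ is a representative system of the isomorphism classes of finite digraphs; constructed digraphs are identified with their representatives. - $\mathfrak{T}_a=\{G\in\mathfrak{D}:G^*\text{ has no closed walk}\}$. - $\mathfrak{P}$ is the set of posets in $\mathfrak{D}$, and $\mathfrak{P}^*=\{P^*:P\in\mathfrak{P}\}$. An S-scheme from $R$ to $S$ with respect to $\mathfrak{D}'$ is a family of maps $\rho_G:\mathcal{S}(G,R)\to\mathcal{S}(G,S)$, $G\in\mathfrak{D}'$. It is strong if each $\rho_G$ is injective. EV-system of $T\in\{R,S\}$ with respect to $\mathfrak{D}'$: - Vertex set $\mathcal{E}_o(T)=\{(v,D,U):v\in V(T),\ D\subseteq N^{in}_T(v),\ U\subseteq N^{out}_T(v)\}$, with components $\mathfrak{a}_1,\mathfrak{a}_2,\mathfrak{a}_3$. - $\phi_T(\mathfrak{a})=\mathfrak{a}_1$. - $\alpha^T_{G,\xi}(v)=(\xi(v),\xi[N^{in}_G(v)],\xi[N^{out}_G(v)])$. - $\mathfrak{a}\mathfrak{b}$ is an arc iff $\mathfrak{a}=\alpha^T_{G,\xi}(v)$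 and $\mathfrak{b}=\alpha^T_{G,\xi}(w)$ for some $G\in\mathfrak{D}'$, $\xi\in\mathcal{S}(G,T)$ and $vw\in A(G)$. In each setting $\mathcal{E}(R)\in\mathfrak{D}'$. $X^m_n$ has vertex set $D\cup\{p\}\cup U$ (disjoint, $\#D=m$, $\#U=n$) and arcs $(D\times\{p\})\cup(\{p\}\times U)$. For $\mathfrak{b}\in\mathcal{E}_o(R)\cup\mathcal{E}_o(S)$, the digraph $X(\mathfrak{b})$ is: - $X^{\#\mathfrak{b}_2}_{\#\mathfrak{b}_3}$ in settings (i) and (ii); - its transitive hull with all loops added in setting (iii); - its transitive hull in setting (iv). $\iota(\mathfrak{a})$ is a fixed map $V(X(\mathfrak{a}))\to V(R)$ sending $p$ to $\mathfrak{a}_1$, $D$ bijectively onto $\mathfrak{a}_2$, and $U$ bijectively onto $\mathfrak{a}_3$. It is a strict homomorphism, and $X(\mathfrak{a})\in\mathfrak{D}'$. -}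

module Defs where

open import Data.Nat using (ℕ; zero; suc; _+_; _≤_; s≤s; z≤n)
open import Data.Nat.Properties using (m≤n+m)
import Data.Nat.Properties
open import Data.Fin using (Fin; zero; suc; _≟_; _↑ˡ_; _↑ʳ_; splitAt)
open import Data.Fin.Subset using (Subset; _∈_; _⊆_; ∣_∣)
open import Data.Bool using (Bool; true; false; _∧_; _∨_; not; T)
open import Data.Vec using (Vec; tabulate; lookup)
open import Data.Sum using (_⊎_; inj₁; inj₂)
open import Data.Product using (Σ; ∃; _×_; _,_; proj₁; proj₂)
open import Data.Empty using (⊥)
open import Relation.Nullary using (¬_; yes; no)
open import Relation.Nullary.Decidable using (⌊_⌋)
open import Relation.Binary.PropositionalEquality using (_≡_; _≢_; refl; sym; cong)
open import Function using (_∘_; _⇔_)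

record Digraph : Set where
  field
    size     : ℕ
    nonempty : 1 ≤ size
    arc      : Fin size → Fin size → Bool
open Digraph public

V : Digraph → Set
V G = Fin (size G)

Arc : (G : Digraph) → V G → V G → Set
Arc G u v = T (arc G u v)

ProperArc : (G : Digraph) → V G → V G → Set
ProperArc G u v = (u ≢ v) × Arc G u v

record SHom (G H : Digraph) : Set where
  field
    map         : V G → V H
    arc-pres    : ∀ u v → Arc G u v → Arc H (map u) (map v)
    proper-pres : ∀ u v → u ≢ v → Arc G u v → map u ≢ map v
open SHom public

_≈ₕ_ : ∀ {G H} → SHom G H → SHom G H → Set
_≈ₕ_ {G} ξ ζ = ∀ (v : V G) → map ξ v ≡ map ζ v

_∘ₕ_ : ∀ {G H K} → SHom H K → SHom G H → SHom G K
_∘ₕ_ {G} {H} {K} ξ ζ = record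
  { map = λ v → map ξ (map ζ v)
  ; arc-pres = λ u v a → arc-pres ξ _ _ (arc-pres ζ u v a)
  ; proper-pres = λ u v u≢v a → proper-pres ξ _ _ (proper-pres ζ u v u≢v a) (arc-pres ζ u v a)
  }

record _≅_ (G H : Digraph) : Set where
  field
    to      : V G → V H
    from    : V H → V G
    from-to : ∀ v → from (to v) ≡ v
    to-from : ∀ w → to (from w) ≡ w
    arc-iff : ∀ u v → arc G u v ≡ arc H (to u) (to v)

Aut : Digraph → Set
Aut G = G ≅ G

autSHom : ∀ {G} → Aut G → SHom G G
autSHom {G} π = record
  { map = to
  ; arc-pres = λ u v a → subst' (arc-iff u v) a
  ; proper-pres = λ u v u≢v a eq → u≢v (inj eq)
  }
  where
  open _≅_ π
  subst' : ∀ {b c : Bool} → b ≡ c → T b → T c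
  subst' refl t = t
  inj : ∀ {u v} → to u ≡ to v → u ≡ v
  inj {u} {v} eq with from-to u | from-to v | cong from eq
  ... | p | q | r = trans' (sym p) (trans' r q)
    where
    trans' : ∀ {A : Set} {x y z : A} → x ≡ y → y ≡ z → x ≡ z
    trans' refl q = q

data Walk (G : Digraph) : V G → V G → Set where
  nil  : ∀ {u} → Walk G u u
  cons : ∀ {u w v} → ProperArc G u w → Walk G w v → Walk G u v

HasClosedWalk : Digraph → Set
HasClosedWalk G = Σ (V G) λ u → Σ (V G) λ w → ProperArc G u w × Walk G w u

InTa : Digraph → Set
InTa G = ¬ HasClosedWalk G

IsPoset : Digraph → Set
IsPoset G =
  (∀ v → Arc G v v) ×
  (∀ u v → Arc G u v → Arc G v u → u ≡ v) ×
  (∀ u v w → Arc G u v → Arc G v w → Arc G u w)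

addLoops : Digraph → Digraph
addLoops G = record
  { size = size G ; nonempty = nonempty G
  ; arc = λ u v → ⌊ u ≟ v ⌋ ∨ arc G u v }

-- 𝔓* : G = P* for a poset P (necessarily P = G with all loops added)
IsPosetStar : Digraph → Set
IsPosetStar G = (∀ v → ¬ Arc G v v) × IsPoset (addLoops G)

IsoClosed : (Digraph → Set) → Set
IsoClosed Dp = ∀ G H → G ≅ H → Dp G → Dp H

-- which version of X(𝔟) is used
data Variant : Set where
  plain poset poset* : Variant

data Setting (Dp : Digraph → Set) (R : Digraph) : Variant → Set where
  setting-i   : (∀ G → Dp G) → Setting Dp R plain
  setting-ii  : IsoClosed Dp → (∀ G → InTa G → Dp G) → InTa R → Setting Dp R plain
  setting-iii : (∀ G → Dp G ⇔ IsPoset G) → IsPoset R → Setting Dp R poset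
  setting-iv  : (∀ G → Dp G ⇔ IsPosetStar G) → IsPosetStar R → Setting Dp R poset*

anyᶠ : ∀ {n} → (Fin n → Bool) → Bool
anyᶠ {zero} f = false
anyᶠ {suc n} f = f zero ∨ anyᶠ (λ i → f (suc i))

Nin : (G : Digraph) → V G → Subset (size G)
Nin G v = tabulate λ w → not ⌊ w ≟ v ⌋ ∧ arc G w v

Nout : (G : Digraph) → V G → Subset (size G)
Nout G v = tabulate λ w → not ⌊ w ≟ v ⌋ ∧ arc G v w

img : ∀ {G T} → SHom G T → Subset (size G) → Subset (size T)
img ξ P = tabulate λ w → anyᶠ λ u → lookup P u ∧ ⌊ map ξ u ≟ w ⌋

Triple : Digraph → Set
Triple T = V T × Subset (size T) × Subset (size T)

α : ∀ {G T} → SHom G T → V G → Triple T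
α {G} ξ v = map ξ v , img ξ (Nin G v) , img ξ (Nout G v)

IsEo : (T : Digraph) → Triple T → Set
IsEo T (v , D , U) = (D ⊆ Nin T v) × (U ⊆ Nout T v)

record SScheme (Dp : Digraph → Set) (R S : Digraph) : Set where
  field
    ρ     : (G : Digraph) → Dp G → SHom G R → SHom G S
    -- ρ_G is a map on S(G,R) (respects equality of homomorphisms,
    -- independent of the membership proof)
    ρ-ext : ∀ G (p q : Dp G) (ξ ζ : SHom G R) → ξ ≈ₕ ζ → ρ G p ξ ≈ₕ ρ G q ζ
open SScheme public

Strong : ∀ {Dp R S} → SScheme Dp R S → Set
Strong {Dp} {R} σ = ∀ G (p : Dp G) (ξ ζ : SHom G R) → ρ σ G p ξ ≈ₕ ρ σ G p ζ → ξ ≈ₕ ζ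

AlphaCompat : ∀ {Dp R S} → SScheme Dp R S → Set
AlphaCompat {Dp} {R} σ =
  ∀ G H (p : Dp G) (q : Dp H) (ξ : SHom G R) (ζ : SHom H R) (v : V G) (w : V H) →
  α ξ v ≡ α ζ w → α (ρ σ G p ξ) v ≡ α (ρ σ H q ζ) w

-- The EV-system 𝓔(R) w.r.t. Dp: a digraph E with a labelling
-- lab : V E → Triple R which is a bijection onto 𝓔_o(R), and whose arcs
-- are exactly as in the definition.

record IsEV (Dp : Digraph → Set) (R E : Digraph) (lab : V E → Triple R) : Set where
  field
    lab-inj  : ∀ i j → lab i ≡ lab j → i ≡ j
    lab-onto : ∀ t → IsEo R t ⇔ (∃ λ i → lab i ≡ t)
    arc-char : ∀ i j → Arc E i j ⇔
      (Σ Digraph λ G → Dp G × Σ (SHom G R) λ ξ → Σ (V G) λ v → Σ (V G) λ w →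
         Arc G v w × α ξ v ≡ lab i × α ξ w ≡ lab j)
open IsEV public

φ : ∀ {Dp R E lab} → IsEV Dp R E lab → SHom E R
φ {Dp} {R} {E} {lab} ev = record
  { map = λ i → proj₁ (lab i)
  ; arc-pres = ap
  ; proper-pres = pp
  }
  where
  ap : ∀ i j → Arc E i j → Arc R (proj₁ (lab i)) (proj₁ (lab j))
  ap i j a with Function.Equivalence.to (arc-char ev i j) a
  ... | G , _ , ξ , v , w , vw , e1 , e2 =
    subst2 (cong proj₁ e1) (cong proj₁ e2) (arc-pres ξ v w vw)
    where
    subst2 : ∀ {x x' y y'} → x ≡ x' → y ≡ y' → Arc R x y → Arc R x' y'
    subst2 refl refl a = a
  pp : ∀ i j → i ≢ j → Arc E i j → proj₁ (lab i) ≢ proj₁ (lab j)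
  pp i j i≢j a with Function.Equivalence.to (arc-char ev i j) a
  ... | G , _ , ξ , v , w , vw , e1 , e2 with v ≟ w
  ... | yes refl = λ _ → i≢j (lab-inj ev i j (trans2 (sym e1) e2))
    where
    trans2 : ∀ {A : Set} {x y z : A} → x ≡ y → y ≡ z → x ≡ z
    trans2 refl q = q
  ... | no v≢w = λ eq → proper-pres ξ v w v≢w vw (fix e1 e2 eq)
    where
    fix : α ξ v ≡ lab i → α ξ w ≡ lab j → proj₁ (lab i) ≡ proj₁ (lab j) → map ξ v ≡ map ξ w
    fix p q e = trans3 (cong proj₁ p) (trans3 e (sym (cong proj₁ q)))
      where
      trans3 : ∀ {A : Set} {x y z : A} → x ≡ y → y ≡ z → x ≡ z
      trans3 refl r = r

-- X^m_n and its variants.  Vertex set Fin (m + suc n):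
--   dV i = D-vertex i,  pV = p,  uV j = U-vertex j.

data Part (m n : ℕ) : Set where
  inD : Fin m → Part m n
  top : Part m n
  inU : Fin n → Part m n

part : ∀ m n → Fin (m + suc n) → Part m n
part m n x with splitAt m x
... | inj₁ i = inD i
... | inj₂ zero = top
... | inj₂ (suc j) = inU j

dV : ∀ {m} n → Fin m → Fin (m + suc n)
dV n i = i ↑ˡ suc n

pV : ∀ m n → Fin (m + suc n)
pV m n = m ↑ʳ zero

uV : ∀ m {n} → Fin n → Fin (m + suc n)
uV m j = m ↑ʳ suc j

baseArc : ∀ {m n} → Part m n → Part m n → Bool
baseArc (inD _) top = true
baseArc top (inU _) = true
baseArc _ _ = false

-- transitive hull: additionally D × U
hullArc : ∀ {m n} → Part m n → Part m n → Bool
hullArc (inD _) (inU _) = true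
hullArc x y = baseArc x y

arcX : Variant → ∀ m n → Fin (m + suc n) → Fin (m + suc n) → Bool
arcX plain  m n x y = baseArc (part m n x) (part m n y)
arcX poset  m n x y = ⌊ x ≟ y ⌋ ∨ hullArc (part m n x) (part m n y)
arcX poset* m n x y = hullArc (part m n x) (part m n y)

Xmn : Variant → ℕ → ℕ → Digraph
Xmn var m n = record
  { size = m + suc n
  ; nonempty = Data.Nat.Properties.≤-trans (s≤s z≤n) (m≤n+m (suc n) m)
  ; arc = arcX var m n }

X : ∀ {T} → Variant → Triple T → Digraph
X var (_ , D , U) = Xmn var ∣ D ∣ ∣ U ∣

IsIota : ∀ {R} var (𝔞 : Triple R) → SHom (X {R} var 𝔞) R → Set
IsIota var (v , D , U) ι =
  (map ι (pV ∣ D ∣ ∣ U ∣) ≡ v) ×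
  (∀ (i j : Fin ∣ D ∣) → map ι (dV ∣ U ∣ i) ≡ map ι (dV ∣ U ∣ j) → i ≡ j) ×
  (∀ w → w ∈ D ⇔ (∃ λ (i : Fin ∣ D ∣) → map ι (dV ∣ U ∣ i) ≡ w)) ×
  (∀ (i j : Fin ∣ U ∣) → map ι (uV ∣ D ∣ i) ≡ map ι (uV ∣ D ∣ j) → i ≡ j) ×
  (∀ w → w ∈ U ⇔ (∃ λ (i : Fin ∣ U ∣) → map ι (uV ∣ D ∣ i) ≡ w))

InjOnDU : ∀ {T S} var (𝔟 : Triple T) → SHom (X {T} var 𝔟) S → Set
InjOnDU var (_ , D , U) ζ =
  (∀ (i j : Fin ∣ D ∣) → map ζ (dV ∣ U ∣ i) ≡ map ζ (dV ∣ U ∣ j) → i ≡ j) ×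
  (∀ (i j : Fin ∣ U ∣) → map ζ (uV ∣ D ∣ i) ≡ map ζ (uV ∣ D ∣ j) → i ≡ j)

-- Strongness and α-compatibility make ρ reflect symmetries: for an automorphism τ of G,
-- α(ξ ∘ τ)(x) = α(ξ)(τ x), so compatibility gives ρ(ξ ∘ τ) = ρ(ξ) ∘ τ; hence if ρ(ξ) is
-- τ-invariant, then ρ(ξ ∘ τ) = ρ(ξ) and strongness yields ξ ∘ τ = ξ. Transposing two D-vertices
-- (or two U-vertices) of X(𝔞) is an automorphism, so ρ(ξ) separates any two such vertices that ξ
-- separates. And ι(𝔞) ∘ π does separate them: they have the common out-neighbour (in-neighbour)
-- π(p), while ι(𝔞) can only merge a source with a sink.
-- For the second claim, α(φ)(𝔞) = 𝔞 = α(ι(𝔞))(p), so compatibility gives ε(𝔞) = α(ρ(ι(𝔞)))(p),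
-- whose last two components are the images of D and U under ρ(ι(𝔞)), which is injective on both.

module Submission where

open import Defs
open import Data.Bool using (Bool; true; false; _∨_; T)
open import Data.Bool.Properties using (T-≡; T-∧; T-∨)
open import Data.Empty using (⊥-elim)
open import Data.Fin using (Fin; zero; suc; _≟_; splitAt; join)
open import Data.Fin.Properties
  using (suc-injective; 0≢1+n; splitAt-↑ˡ; splitAt-↑ʳ; join-splitAt; ↑ˡ-injective; ↑ʳ-injective)
open import Data.Fin.Permutation.Components using (transpose; transpose-inverse)
open import Data.Fin.Subset using (Subset; _∈_; _∉_; _⊆_; ∣_∣; _-_; ⁅_⁆; inside; outside; Empty)
open import Data.Fin.Subset.Properties
  using (⊆-antisym; p─⊥≡p; p─q⊆p; x∈p∧x≢y⇒x∈p-y; Empty-unique; ∣⊥∣≡0)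
open import Data.Nat using (ℕ; zero; suc; _+_)
open import Data.Product using (_×_; ∃; _,_; proj₁; proj₂)
open import Data.Sum using (_⊎_; inj₁; inj₂)
open import Data.Unit using (tt)
open import Data.Vec using (_∷_; tabulate; lookup; here; there)
open import Data.Vec.Properties using (lookup∘tabulate; []=⇒lookup; lookup⇒[]=)
open import Function using (_∘_; id; Equivalence)
open import Function.Definitions using (Injective)
open import Relation.Nullary using (¬_; yes; no)
open import Relation.Nullary.Decidable
  using (⌊_⌋; dec-true; toWitness; fromWitness; toWitnessFalse; fromWitnessFalse)
open import Relation.Binary.PropositionalEquality
  using (_≡_; _≢_; refl; sym; trans; cong; cong₂; subst; subst₂; ≢-sym; module ≡-Reasoning)

open _≅_ using (to; from; from-to; to-from; arc-iff)

∈⇒T-lookup : ∀ {k} {p : Subset k} {x} → x ∈ p → T (lookup p x)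
∈⇒T-lookup x∈p = Equivalence.from T-≡ ([]=⇒lookup x∈p)

T-lookup⇒∈ : ∀ {k} {p : Subset k} {x} → T (lookup p x) → x ∈ p
T-lookup⇒∈ {p = p} {x} t = lookup⇒[]= x p (Equivalence.to T-≡ t)

∈-tabulate⁺ : ∀ {k} (f : Fin k → Bool) {x} → T (f x) → x ∈ tabulate f
∈-tabulate⁺ f {x} t = T-lookup⇒∈ (subst T (sym (lookup∘tabulate f x)) t)

∈-tabulate⁻ : ∀ {k} (f : Fin k → Bool) {x} → x ∈ tabulate f → T (f x)
∈-tabulate⁻ f {x} x∈ = subst T (lookup∘tabulate f x) (∈⇒T-lookup x∈)

T-anyᶠ⁺ : ∀ {k} (f : Fin k → Bool) x → T (f x) → T (anyᶠ f)
T-anyᶠ⁺ f zero    t = Equivalence.from T-∨ (inj₁ t)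
T-anyᶠ⁺ f (suc x) t = Equivalence.from T-∨ (inj₂ (T-anyᶠ⁺ (f ∘ suc) x t))

T-anyᶠ⁻ : ∀ {k} (f : Fin k → Bool) → T (anyᶠ f) → ∃ λ x → T (f x)
T-anyᶠ⁻ {suc k} f t with Equivalence.to T-∨ t
... | inj₁ t₀ = zero , t₀
... | inj₂ t₊ with T-anyᶠ⁻ (f ∘ suc) t₊
...   | x , tx = suc x , tx

∣p∣≡1+∣p-x∣ : ∀ {k} {p : Subset k} {x} → x ∈ p → ∣ p ∣ ≡ suc ∣ p - x ∣
∣p∣≡1+∣p-x∣ {p = inside ∷ p} here = cong (suc ∘ ∣_∣) (sym (p─⊥≡p p))
∣p∣≡1+∣p-x∣ {p = inside ∷ p} (there x∈p) = cong suc (∣p∣≡1+∣p-x∣ x∈p)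
∣p∣≡1+∣p-x∣ {p = outside ∷ p} (there x∈p) = ∣p∣≡1+∣p-x∣ x∈p

x∉p-x : ∀ {k} (x : Fin k) {p : Subset k} → x ∉ p - x
x∉p-x zero    {_ ∷ _} ()
x∉p-x (suc x) {_ ∷ _} (there x∈) = x∉p-x x x∈

injective-enumeration⇒∣p∣≡m : ∀ {k m} (f : Fin m → Fin k) → Injective _≡_ _≡_ f →
  {p : Subset k} → (∀ {y} → y ∈ p → ∃ λ i → f i ≡ y) → (∀ i → f i ∈ p) → ∣ p ∣ ≡ m
injective-enumeration⇒∣p∣≡m {k} {m = zero} f _ onto _ =
  trans (cong ∣_∣ (Empty-unique no-member)) (∣⊥∣≡0 k)
  where
  no-member : Empty _
  no-member (_ , y∈) with onto y∈
  ... | () , _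
injective-enumeration⇒∣p∣≡m {m = suc m} f inj {p} onto into =
  trans (∣p∣≡1+∣p-x∣ (into zero))
        (cong suc (injective-enumeration⇒∣p∣≡m (f ∘ suc) (suc-injective ∘ inj) onto′ into′))
  where
  onto′ : ∀ {y} → y ∈ p - f zero → ∃ λ i → f (suc i) ≡ y
  onto′ y∈ with onto (p─q⊆p p ⁅ f zero ⁆ y∈)
  ... | zero  , refl = ⊥-elim (x∉p-x (f zero) y∈)
  ... | suc i , fi≡y = i , fi≡y
  into′ : ∀ i → f (suc i) ∈ p - f zero
  into′ i = x∈p∧x≢y⇒x∈p-y (into (suc i)) (0≢1+n ∘ sym ∘ inj)

transpose-matchˡ : ∀ {k} (a b : Fin k) → transpose a b a ≡ b
transpose-matchˡ a b rewrite dec-true (a ≟ a) refl = refl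

transpose-cong : ∀ {k} {A : Set} (f : Fin k → A) {a b} → f a ≡ f b → ∀ x → f (transpose a b x) ≡ f x
transpose-cong f {a} {b} fa≡fb x with x ≟ a
... | yes refl = sym fa≡fb
... | no _ with x ≟ b
...   | yes refl = fa≡fb
...   | no _ = refl

⌊≟⌋-injective : ∀ {k l} {f : Fin k → Fin l} → Injective _≡_ _≡_ f →
  ∀ x y → ⌊ f x ≟ f y ⌋ ≡ ⌊ x ≟ y ⌋
⌊≟⌋-injective {f = f} inj x y with x ≟ y | f x ≟ f y
... | yes _   | yes _     = refl
... | no _    | no _      = refl
... | yes x≡y | no fx≢fy  = ⊥-elim (fx≢fy (cong f x≡y))
... | no x≢y  | yes fx≡fy = ⊥-elim (x≢y (inj fx≡fy))

∈-img⁺ : ∀ {G H} (ξ : SHom G H) P {u} → u ∈ P → map ξ u ∈ img ξ P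
∈-img⁺ ξ P {u} u∈P =
  ∈-tabulate⁺ _ (T-anyᶠ⁺ _ u (Equivalence.from T-∧ (∈⇒T-lookup u∈P , fromWitness refl)))

∈-img⁻ : ∀ {G H} (ξ : SHom G H) P {w} → w ∈ img ξ P → ∃ λ u → u ∈ P × map ξ u ≡ w
∈-img⁻ ξ P w∈ with T-anyᶠ⁻ _ (∈-tabulate⁻ _ w∈)
... | u , t with Equivalence.to T-∧ t
...   | u∈P , ξu≡w = u , T-lookup⇒∈ u∈P , toWitness ξu≡w

∈-Nin⁺ : ∀ G {v w} → w ≢ v → Arc G w v → w ∈ Nin G v
∈-Nin⁺ G w≢v a = ∈-tabulate⁺ _ (Equivalence.from T-∧ (fromWitnessFalse w≢v , a))

∈-Nin⁻ : ∀ G {v w} → w ∈ Nin G v → w ≢ v × Arc G w v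
∈-Nin⁻ G w∈ with Equivalence.to T-∧ (∈-tabulate⁻ _ w∈)
... | w≢v , a = toWitnessFalse w≢v , a

-- Nin (reverse G) v and Nout G v are definitionally equal.
reverse : Digraph → Digraph
reverse G = record G { arc = λ u v → arc G v u }

∈-Nout⁺ : ∀ G {v w} → w ≢ v → Arc G v w → w ∈ Nout G v
∈-Nout⁺ G = ∈-Nin⁺ (reverse G)

∈-Nout⁻ : ∀ G {v w} → w ∈ Nout G v → w ≢ v × Arc G v w
∈-Nout⁻ G = ∈-Nin⁻ (reverse G)

img-∘ : ∀ {G H K} (ξ : SHom H K) (ζ : SHom G H) P → img (ξ ∘ₕ ζ) P ≡ img ξ (img ζ P)
img-∘ ξ ζ P = ⊆-antisym forward backward
  where
  forward : img (ξ ∘ₕ ζ) P ⊆ img ξ (img ζ P)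
  forward w∈ with ∈-img⁻ (ξ ∘ₕ ζ) P w∈
  ... | u , u∈P , refl = ∈-img⁺ ξ (img ζ P) (∈-img⁺ ζ P u∈P)
  backward : img ξ (img ζ P) ⊆ img (ξ ∘ₕ ζ) P
  backward w∈ with ∈-img⁻ ξ (img ζ P) w∈
  ... | y , y∈ , refl with ∈-img⁻ ζ P y∈
  ...   | u , u∈P , refl = ∈-img⁺ (ξ ∘ₕ ζ) P u∈P

to-injective : ∀ {G H} (π : G ≅ H) {x y} → to π x ≡ to π y → x ≡ y
to-injective π {x} {y} eq = trans (sym (from-to π x)) (trans (cong (from π) eq) (from-to π y))

img-Nin-aut : ∀ {G} (τ : Aut G) x → img (autSHom τ) (Nin G x) ≡ Nin G (to τ x)
img-Nin-aut {G} τ x = ⊆-antisym forward backward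
  where
  forward : img (autSHom τ) (Nin G x) ⊆ Nin G (to τ x)
  forward w∈ with ∈-img⁻ (autSHom τ) (Nin G x) w∈
  ... | u , u∈ , refl with ∈-Nin⁻ G u∈
  ...   | u≢x , a = ∈-Nin⁺ G (u≢x ∘ to-injective τ) (arc-pres (autSHom τ) u x a)
  backward : Nin G (to τ x) ⊆ img (autSHom τ) (Nin G x)
  backward {w} w∈ with ∈-Nin⁻ G w∈
  ... | w≢τx , a =
    subst (_∈ img (autSHom τ) (Nin G x)) (to-from τ w) (∈-img⁺ (autSHom τ) (Nin G x) (∈-Nin⁺ G u≢x u→x))
    where
    u≢x : from τ w ≢ x
    u≢x refl = w≢τx (sym (to-from τ w))
    u→x : Arc G (from τ w) x
    u→x = subst T (sym (arc-iff τ (from τ w) x)) (subst (λ y → Arc G y (to τ x)) (sym (to-from τ w)) a)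

reverseAut : ∀ {G} → Aut G → Aut (reverse G)
reverseAut τ = record
  { to = to τ ; from = from τ ; from-to = from-to τ ; to-from = to-from τ
  ; arc-iff = λ u v → arc-iff τ v u }

img-Nout-aut : ∀ {G} (τ : Aut G) x → img (autSHom τ) (Nout G x) ≡ Nout G (to τ x)
img-Nout-aut τ = img-Nin-aut (reverseAut τ)

α-aut : ∀ {G H} (ξ : SHom G H) (τ : Aut G) x → α (ξ ∘ₕ autSHom τ) x ≡ α ξ (to τ x)
α-aut {G} ξ τ x = cong₂ _,_ refl (cong₂ _,_
  (trans (img-∘ ξ (autSHom τ) (Nin G x)) (cong (img ξ) (img-Nin-aut τ x)))
  (trans (img-∘ ξ (autSHom τ) (Nout G x)) (cong (img ξ) (img-Nout-aut τ x))))

α-isEo : ∀ {G H} (ξ : SHom G H) v → IsEo H (α ξ v)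
α-isEo {G} {H} ξ v = Nin-image , Nout-image
  where
  Nin-image : img ξ (Nin G v) ⊆ Nin H (map ξ v)
  Nin-image w∈ with ∈-img⁻ ξ (Nin G v) w∈
  ... | u , u∈ , refl with ∈-Nin⁻ G u∈
  ...   | u≢v , a = ∈-Nin⁺ H (proper-pres ξ u v u≢v a) (arc-pres ξ u v a)
  Nout-image : img ξ (Nout G v) ⊆ Nout H (map ξ v)
  Nout-image w∈ with ∈-img⁻ ξ (Nout G v) w∈
  ... | u , u∈ , refl with ∈-Nout⁻ G u∈
  ...   | u≢v , a = ∈-Nout⁺ H (≢-sym (proper-pres ξ v u (≢-sym u≢v) a)) (arc-pres ξ v u a)

module _ {Dp R E lab} (ev : IsEV Dp R E lab) where

  img-φ-Nin⊆ : ∀ i → img (φ ev) (Nin E i) ⊆ proj₁ (proj₂ (lab i))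
  img-φ-Nin⊆ i w∈ with ∈-img⁻ (φ ev) (Nin E i) w∈
  ... | j , j∈ , refl with ∈-Nin⁻ E j∈
  ...   | j≢i , j→i with Equivalence.to (arc-char ev j i) j→i
  ...     | G , _ , ξ , u , v , u→v , αu≡ , αv≡ =
    subst₂ _∈_ (cong proj₁ αu≡) (cong (proj₁ ∘ proj₂) αv≡)
               (∈-img⁺ ξ (Nin G v) (∈-Nin⁺ G u≢v u→v))
    where
    u≢v : u ≢ v
    u≢v u≡v = j≢i (lab-inj ev j i (trans (sym αu≡) (trans (cong (α ξ) u≡v) αv≡)))

  img-φ-Nout⊆ : ∀ i → img (φ ev) (Nout E i) ⊆ proj₂ (proj₂ (lab i))
  img-φ-Nout⊆ i w∈ with ∈-img⁻ (φ ev) (Nout E i) w∈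
  ... | j , j∈ , refl with ∈-Nout⁻ E j∈
  ...   | j≢i , i→j with Equivalence.to (arc-char ev i j) i→j
  ...     | G , _ , ξ , u , v , u→v , αu≡ , αv≡ =
    subst₂ _∈_ (cong proj₁ αv≡) (cong (proj₂ ∘ proj₂) αu≡)
               (∈-img⁺ ξ (Nout G u) (∈-Nout⁺ G v≢u u→v))
    where
    v≢u : v ≢ u
    v≢u v≡u = j≢i (lab-inj ev j i (trans (sym αv≡) (trans (cong (α ξ) v≡u) αu≡)))

  module _ {G} (pG : Dp G) (ξ : SHom G R) {v i} (realised : α ξ v ≡ lab i) where

    img-φ-Nin⊇ : proj₁ (proj₂ (lab i)) ⊆ img (φ ev) (Nin E i)
    img-φ-Nin⊇ w∈
      with ∈-img⁻ ξ (Nin G v) (subst (_ ∈_) (sym (cong (proj₁ ∘ proj₂) realised)) w∈)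
    ... | u , u∈ , refl with ∈-Nin⁻ G u∈
    ...   | u≢v , u→v with Equivalence.to (lab-onto ev (α ξ u)) (α-isEo ξ u)
    ...     | j , lab-j≡ =
      subst (_∈ img (φ ev) (Nin E i)) (cong proj₁ lab-j≡)
            (∈-img⁺ (φ ev) (Nin E i) (∈-Nin⁺ E j≢i j→i))
      where
      j→i : Arc E j i
      j→i = Equivalence.from (arc-char ev j i) (G , pG , ξ , u , v , u→v , sym lab-j≡ , realised)
      j≢i : j ≢ i
      j≢i refl = proper-pres ξ u v u≢v u→v (trans (sym (cong proj₁ lab-j≡)) (sym (cong proj₁ realised)))

    img-φ-Nout⊇ : proj₂ (proj₂ (lab i)) ⊆ img (φ ev) (Nout E i)
    img-φ-Nout⊇ w∈
      with ∈-img⁻ ξ (Nout G v) (subst (_ ∈_) (sym (cong (proj₂ ∘ proj₂) realised)) w∈)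
    ... | u , u∈ , refl with ∈-Nout⁻ G u∈
    ...   | u≢v , v→u with Equivalence.to (lab-onto ev (α ξ u)) (α-isEo ξ u)
    ...     | j , lab-j≡ =
      subst (_∈ img (φ ev) (Nout E i)) (cong proj₁ lab-j≡)
            (∈-img⁺ (φ ev) (Nout E i) (∈-Nout⁺ E j≢i i→j))
      where
      i→j : Arc E i j
      i→j = Equivalence.from (arc-char ev i j) (G , pG , ξ , v , u , v→u , realised , sym lab-j≡)
      j≢i : j ≢ i
      j≢i refl = proper-pres ξ v u (≢-sym u≢v) v→u (trans (cong proj₁ realised) (cong proj₁ lab-j≡))

    α-φ : α (φ ev) i ≡ lab i
    α-φ = cong₂ _,_ refl (cong₂ _,_ (⊆-antisym (img-φ-Nin⊆ i) img-φ-Nin⊇)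
                                    (⊆-antisym (img-φ-Nout⊆ i) img-φ-Nout⊇))

module _ {Dp R S} (σ : SScheme Dp R S) (strong : Strong σ) (compat : AlphaCompat σ) where

  ρ-invariant⇒invariant : ∀ {G} (pG : Dp G) (ξ : SHom G R) (τ : Aut G) →
    (∀ x → map (ρ σ G pG ξ) (to τ x) ≡ map (ρ σ G pG ξ) x) → ∀ x → map ξ (to τ x) ≡ map ξ x
  ρ-invariant⇒invariant {G} pG ξ τ invariant = strong G pG (ξ ∘ₕ autSHom τ) ξ ρ-agree
    where
    ρ-agree : ρ σ G pG (ξ ∘ₕ autSHom τ) ≈ₕ ρ σ G pG ξ
    ρ-agree x = trans (cong proj₁ (compat G G pG pG _ ξ x (to τ x) (α-aut ξ τ x))) (invariant x)

data Kind : Set where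
  down apex up : Kind

partKind : ∀ {m n} → Part m n → Kind
partKind (inD _) = down
partKind top     = apex
partKind (inU _) = up

kind : ∀ m n → Fin (m + suc n) → Kind
kind m n x = partKind (part m n x)

kind-dV : ∀ m n i → kind m n (dV n i) ≡ down
kind-dV m n i rewrite splitAt-↑ˡ m i (suc n) = refl

kind-pV : ∀ m n → kind m n (pV m n) ≡ apex
kind-pV m n rewrite splitAt-↑ʳ m (suc n) zero = refl

kind-uV : ∀ m n j → kind m n (uV m j) ≡ up
kind-uV m n j rewrite splitAt-↑ʳ m (suc n) (suc j) = refl

≢-by-kind : ∀ {m n x y k l} → kind m n x ≡ k → kind m n y ≡ l → k ≢ l → x ≢ y
≢-by-kind refl refl k≢l refl = k≢l refl

dV≢pV : ∀ {m n} i → dV {m} n i ≢ pV m n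
dV≢pV {m} {n} i = ≢-by-kind (kind-dV m n i) (kind-pV m n) λ ()

uV≢pV : ∀ {m n} j → uV m {n} j ≢ pV m n
uV≢pV {m} {n} j = ≢-by-kind (kind-uV m n j) (kind-pV m n) λ ()

dV≢uV : ∀ {m n} i j → dV {m} n i ≢ uV m j
dV≢uV {m} {n} i j = ≢-by-kind (kind-dV m n i) (kind-uV m n j) λ ()

data View (m n : ℕ) : Fin (m + suc n) → Set where
  atD : ∀ i → View m n (dV n i)
  atP : View m n (pV m n)
  atU : ∀ j → View m n (uV m j)

view : ∀ m n x → View m n x
view m n x = viewJoin (splitAt m x) (join-splitAt m (suc n) x)
  where
  viewJoin : ∀ {x} s → join m (suc n) s ≡ x → View m n x
  viewJoin (inj₁ i)       refl = atD i
  viewJoin (inj₂ zero)    refl = atP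
  viewJoin (inj₂ (suc j)) refl = atU j

baseᴷ : Kind → Kind → Bool
baseᴷ down apex = true
baseᴷ apex up   = true
baseᴷ _    _    = false

hullᴷ : Kind → Kind → Bool
hullᴷ down up = true
hullᴷ k    l  = baseᴷ k l

arcᴷ : Variant → Bool → Kind → Kind → Bool
arcᴷ plain  _    k l = baseᴷ k l
arcᴷ poset  loop k l = loop ∨ hullᴷ k l
arcᴷ poset* _    k l = hullᴷ k l

baseArc-kind : ∀ {m n} (P Q : Part m n) → baseArc P Q ≡ baseᴷ (partKind P) (partKind Q)
baseArc-kind (inD _) (inD _) = refl
baseArc-kind (inD _) top     = refl
baseArc-kind (inD _) (inU _) = refl
baseArc-kind top     (inD _) = refl
baseArc-kind top     top     = refl
baseArc-kind top     (inU _) = refl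
baseArc-kind (inU _) (inD _) = refl
baseArc-kind (inU _) top     = refl
baseArc-kind (inU _) (inU _) = refl

hullArc-kind : ∀ {m n} (P Q : Part m n) → hullArc P Q ≡ hullᴷ (partKind P) (partKind Q)
hullArc-kind (inD _) (inD _) = refl
hullArc-kind (inD _) top     = refl
hullArc-kind (inD _) (inU _) = refl
hullArc-kind top     (inD _) = refl
hullArc-kind top     top     = refl
hullArc-kind top     (inU _) = refl
hullArc-kind (inU _) (inD _) = refl
hullArc-kind (inU _) top     = refl
hullArc-kind (inU _) (inU _) = refl

arcX≡arcᴷ : ∀ var m n x y → arcX var m n x y ≡ arcᴷ var ⌊ x ≟ y ⌋ (kind m n x) (kind m n y)
arcX≡arcᴷ plain  m n x y = baseArc-kind (part m n x) (part m n y)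
arcX≡arcᴷ poset  m n x y = cong (⌊ x ≟ y ⌋ ∨_) (hullArc-kind (part m n x) (part m n y))
arcX≡arcᴷ poset* m n x y = hullArc-kind (part m n x) (part m n y)

arcX-kind : ∀ {var m n x y k l} → kind m n x ≡ k → kind m n y ≡ l →
  arcX var m n x y ≡ arcᴷ var ⌊ x ≟ y ⌋ k l
arcX-kind {var} {m} {n} {x} {y} refl refl = arcX≡arcᴷ var m n x y

properArc≡arcᴷ : ∀ var {m n x y k l} → x ≢ y → kind m n x ≡ k → kind m n y ≡ l →
  arcX var m n x y ≡ arcᴷ var false k l
properArc≡arcᴷ var {m} {n} {x} {y} x≢y kx ky with x ≟ y | arcX-kind {var} kx ky
... | yes x≡y | _  = ⊥-elim (x≢y x≡y)
... | no _    | eq = eq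

arc-dV-pV : ∀ {var m n} i → Arc (Xmn var m n) (dV n i) (pV m n)
arc-dV-pV {var} {m} {n} i =
  subst T (sym (properArc≡arcᴷ var (dV≢pV i) (kind-dV m n i) (kind-pV m n))) (down→apex var)
  where
  down→apex : ∀ var → T (arcᴷ var false down apex)
  down→apex plain  = tt
  down→apex poset  = tt
  down→apex poset* = tt

arc-pV-uV : ∀ {var m n} j → Arc (Xmn var m n) (pV m n) (uV m j)
arc-pV-uV {var} {m} {n} j =
  subst T (sym (properArc≡arcᴷ var (≢-sym (uV≢pV j)) (kind-pV m n) (kind-uV m n j))) (apex→up var)
  where
  apex→up : ∀ var → T (arcᴷ var false apex up)
  apex→up plain  = tt
  apex→up poset  = tt
  apex→up poset* = tt

arc-dV-uV : ∀ {var m n} → var ≢ plain → ∀ i j → Arc (Xmn var m n) (dV n i) (uV m j)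
arc-dV-uV {var} {m} {n} not-plain i j =
  subst T (sym (properArc≡arcᴷ var (dV≢uV i j) (kind-dV m n i) (kind-uV m n j))) (down→up var not-plain)
  where
  down→up : ∀ var → var ≢ plain → T (arcᴷ var false down up)
  down→up plain  not-plain = ⊥-elim (not-plain refl)
  down→up poset  _         = tt
  down→up poset* _         = tt

Nin-pV⁻ : ∀ {var m n x} → x ∈ Nin (Xmn var m n) (pV m n) → ∃ λ i → x ≡ dV n i
Nin-pV⁻ {var} {m} {n} {x} x∈ with ∈-Nin⁻ (Xmn var m n) x∈ | view m n x
... | _       , _   | atD i = i , refl
... | x≢p     , _   | atP   = ⊥-elim (x≢p refl)
... | x≢p     , x→p | atU j =
  ⊥-elim (no-up→apex var (subst T (properArc≡arcᴷ var x≢p (kind-uV m n j) (kind-pV m n)) x→p))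
  where
  no-up→apex : ∀ var → ¬ T (arcᴷ var false up apex)
  no-up→apex plain  ()
  no-up→apex poset  ()
  no-up→apex poset* ()

Nout-pV⁻ : ∀ {var m n x} → x ∈ Nout (Xmn var m n) (pV m n) → ∃ λ j → x ≡ uV m j
Nout-pV⁻ {var} {m} {n} {x} x∈ with ∈-Nout⁻ (Xmn var m n) x∈ | view m n x
... | _       , _   | atU j = j , refl
... | x≢p     , _   | atP   = ⊥-elim (x≢p refl)
... | x≢p     , p→x | atD i =
  ⊥-elim (no-apex→down var (subst T (properArc≡arcᴷ var (≢-sym x≢p) (kind-pV m n) (kind-dV m n i)) p→x))
  where
  no-apex→down : ∀ var → ¬ T (arcᴷ var false apex down)
  no-apex→down plain  ()
  no-apex→down poset  ()
  no-apex→down poset* ()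

module _ {var m n H} (ξ : SHom (Xmn var m n) H) where

  private
    G = Xmn var m n
    p = pV m n

  img-Nin-pV⁺ : ∀ i → map ξ (dV n i) ∈ img ξ (Nin G p)
  img-Nin-pV⁺ i = ∈-img⁺ ξ (Nin G p) (∈-Nin⁺ G (dV≢pV i) (arc-dV-pV {var} i))

  img-Nin-pV⁻ : ∀ {w} → w ∈ img ξ (Nin G p) → ∃ λ i → map ξ (dV n i) ≡ w
  img-Nin-pV⁻ w∈ with ∈-img⁻ ξ (Nin G p) w∈
  ... | x , x∈ , ξx≡w with Nin-pV⁻ {var} x∈
  ...   | i , refl = i , ξx≡w

  img-Nout-pV⁺ : ∀ j → map ξ (uV m j) ∈ img ξ (Nout G p)
  img-Nout-pV⁺ j = ∈-img⁺ ξ (Nout G p) (∈-Nout⁺ G (uV≢pV j) (arc-pV-uV {var} j))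

  img-Nout-pV⁻ : ∀ {w} → w ∈ img ξ (Nout G p) → ∃ λ j → map ξ (uV m j) ≡ w
  img-Nout-pV⁻ w∈ with ∈-img⁻ ξ (Nout G p) w∈
  ... | x , x∈ , ξx≡w with Nout-pV⁻ {var} x∈
  ...   | j , refl = j , ξx≡w

  ∣img-Nin-pV∣ : (∀ i j → map ξ (dV n i) ≡ map ξ (dV n j) → i ≡ j) →
    ∣ img ξ (Nin G p) ∣ ≡ m
  ∣img-Nin-pV∣ inj = injective-enumeration⇒∣p∣≡m (map ξ ∘ dV n) (inj _ _) img-Nin-pV⁻ img-Nin-pV⁺

  ∣img-Nout-pV∣ : (∀ i j → map ξ (uV m i) ≡ map ξ (uV m j) → i ≡ j) →
    ∣ img ξ (Nout G p) ∣ ≡ n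
  ∣img-Nout-pV∣ inj = injective-enumeration⇒∣p∣≡m (map ξ ∘ uV m) (inj _ _) img-Nout-pV⁻ img-Nout-pV⁺

Sink : (G : Digraph) → V G → Set
Sink G x = ∀ y → ¬ Arc G x y

Source : (G : Digraph) → V G → Set
Source G x = ∀ y → ¬ Arc G y x

uV-sink : ∀ {m n} j → Sink (Xmn plain m n) (uV m j)
uV-sink {m} {n} j y = no-base-from-up (kind m n y) ∘ subst T (arcX-kind {plain} (kind-uV m n j) refl)
  where
  no-base-from-up : ∀ k → ¬ T (baseᴷ up k)
  no-base-from-up down ()
  no-base-from-up apex ()
  no-base-from-up up   ()

dV-source : ∀ {m n} i → Source (Xmn plain m n) (dV n i)
dV-source {m} {n} i y = no-base-into-down (kind m n y) ∘ subst T (arcX-kind {plain} refl (kind-dV m n i))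
  where
  no-base-into-down : ∀ k → ¬ T (baseᴷ k down)
  no-base-into-down down ()
  no-base-into-down apex ()
  no-base-into-down up   ()

dV≡uV⇒sink×source : ∀ {var m n R} (ξ : SHom (Xmn var m n) R) i j → map ξ (dV n i) ≡ map ξ (uV m j) →
  Sink (Xmn var m n) (uV m j) × Source (Xmn var m n) (dV n i)
dV≡uV⇒sink×source {plain}  ξ i j _  = uV-sink j , dV-source i
dV≡uV⇒sink×source {poset}  ξ i j = ⊥-elim ∘ proper-pres ξ _ _ (dV≢uV i j) (arc-dV-uV {poset} (λ ()) i j)
dV≡uV⇒sink×source {poset*} ξ i j = ⊥-elim ∘ proper-pres ξ _ _ (dV≢uV i j) (arc-dV-uV {poset*} (λ ()) i j)

transposition : ∀ {var m n} {a b : Fin (m + suc n)} → kind m n a ≡ kind m n b → Aut (Xmn var m n)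
transposition {var} {m} {n} {a} {b} same = record
  { to      = transpose a b
  ; from    = transpose b a
  ; from-to = λ _ → transpose-inverse b a
  ; to-from = λ _ → transpose-inverse a b
  ; arc-iff = arc-invariant
  }
  where
  τ = transpose a b
  τ-injective : Injective _≡_ _≡_ τ
  τ-injective τx≡τy =
    trans (sym (transpose-inverse b a)) (trans (cong (transpose b a) τx≡τy) (transpose-inverse b a))
  open ≡-Reasoning
  arc-invariant : ∀ u v → arcX var m n u v ≡ arcX var m n (τ u) (τ v)
  arc-invariant u v = begin
    arcX var m n u v
      ≡⟨ arcX≡arcᴷ var m n u v ⟩
    arcᴷ var ⌊ u ≟ v ⌋ (kind m n u) (kind m n v)
      ≡⟨ cong (λ e → arcᴷ var e _ _) (⌊≟⌋-injective τ-injective u v) ⟨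
    arcᴷ var ⌊ τ u ≟ τ v ⌋ (kind m n u) (kind m n v)
      ≡⟨ arcX-kind {var} (transpose-cong (kind m n) same u) (transpose-cong (kind m n) same v) ⟨
    arcX var m n (τ u) (τ v)
      ∎

module _ {Dp R S} (σ : SScheme Dp R S) (strong : Strong σ) (compat : AlphaCompat σ) where

  ρ-identifies⇒identifies : ∀ {var m n} (pX : Dp (Xmn var m n)) (ξ : SHom (Xmn var m n) R) {a b} →
    kind m n a ≡ kind m n b → map (ρ σ _ pX ξ) a ≡ map (ρ σ _ pX ξ) b → map ξ a ≡ map ξ b
  ρ-identifies⇒identifies {var} pX ξ {a} {b} same ρξa≡ρξb =
    sym (subst (λ z → map ξ z ≡ map ξ a) (transpose-matchˡ a b) ξτa≡ξa)
    where
    ρξ-invariant : ∀ x → map (ρ σ _ pX ξ) (transpose a b x) ≡ map (ρ σ _ pX ξ) x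
    ρξ-invariant = transpose-cong (map (ρ σ _ pX ξ)) ρξa≡ρξb
    ξτa≡ξa : map ξ (transpose a b a) ≡ map ξ a
    ξτa≡ξa = ρ-invariant⇒invariant σ strong compat pX ξ (transposition {var} same) ρξ-invariant a

  ρ-InjOnDU : ∀ {Q} var (𝔟 : Triple Q) (pX : Dp (X {Q} var 𝔟)) (ξ : SHom (X {Q} var 𝔟) R) →
    InjOnDU {Q} var 𝔟 ξ → InjOnDU {Q} var 𝔟 (ρ σ (X {Q} var 𝔟) pX ξ)
  ρ-InjOnDU var 𝔟 pX ξ (injᴰ , injᵁ) =
    (λ i j → injᴰ i j ∘ ρ-identifies⇒identifies {var} pX ξ (trans (kind-dV _ _ i) (sym (kind-dV _ _ j)))) ,
    (λ i j → injᵁ i j ∘ ρ-identifies⇒identifies {var} pX ξ (trans (kind-uV _ _ i) (sym (kind-uV _ _ j))))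

module Separation {R var m n} (ι : SHom (Xmn var m n) R)
  (ι-injᴰ : ∀ i j → map ι (dV n i) ≡ map ι (dV n j) → i ≡ j)
  (ι-injᵁ : ∀ i j → map ι (uV m i) ≡ map ι (uV m j) → i ≡ j)
  (ιdV≢ιpV : ∀ i → map ι (dV n i) ≢ map ι (pV m n))
  (ιuV≢ιpV : ∀ j → map ι (uV m j) ≢ map ι (pV m n)) where

  private
    G = Xmn var m n

  ι-identifies : ∀ {x y} → map ι x ≡ map ι y →
    x ≡ y ⊎ (Sink G x ⊎ Sink G y) × (Source G x ⊎ Source G y)
  ι-identifies {x} {y} eq with view m n x | view m n y
  ... | atD i | atD j = inj₁ (cong (dV n) (ι-injᴰ i j eq))
  ... | atD i | atP   = ⊥-elim (ιdV≢ιpV i eq)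
  ... | atD i | atU j = let (sink , source) = dV≡uV⇒sink×source {var} ι i j eq
                        in inj₂ (inj₂ sink , inj₁ source)
  ... | atP   | atD j = ⊥-elim (ιdV≢ιpV j (sym eq))
  ... | atP   | atP   = inj₁ refl
  ... | atP   | atU j = ⊥-elim (ιuV≢ιpV j (sym eq))
  ... | atU i | atD j = let (sink , source) = dV≡uV⇒sink×source {var} ι j i (sym eq)
                        in inj₂ (inj₁ sink , inj₂ source)
  ... | atU i | atP   = ⊥-elim (ιuV≢ιpV i eq)
  ... | atU i | atU j = inj₁ (cong (uV m) (ι-injᵁ i j eq))

  ι-injective-on-non-sinks : ∀ {x y c c′} → Arc G x c → Arc G y c′ → map ι x ≡ map ι y → x ≡ y
  ι-injective-on-non-sinks x→c y→c′ eq with ι-identifies eq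
  ... | inj₁ x≡y                = x≡y
  ... | inj₂ (inj₁ x-sink , _) = ⊥-elim (x-sink _ x→c)
  ... | inj₂ (inj₂ y-sink , _) = ⊥-elim (y-sink _ y→c′)

  ι-injective-on-non-sources : ∀ {x y c c′} → Arc G c x → Arc G c′ y → map ι x ≡ map ι y → x ≡ y
  ι-injective-on-non-sources c→x c′→y eq with ι-identifies eq
  ... | inj₁ x≡y                  = x≡y
  ... | inj₂ (_ , inj₁ x-source) = ⊥-elim (x-source _ c→x)
  ... | inj₂ (_ , inj₂ y-source) = ⊥-elim (y-source _ c′→y)

  module _ (π : Aut G) where

    private
      π-arc : ∀ {u v} → Arc G u v → Arc G (to π u) (to π v)
      π-arc = arc-pres (autSHom π) _ _

    ι∘π-injᴰ : ∀ i j → map ι (to π (dV n i)) ≡ map ι (to π (dV n j)) → i ≡ j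
    ι∘π-injᴰ i j = ↑ˡ-injective (suc n) i j ∘ to-injective π
                 ∘ ι-injective-on-non-sinks (π-arc (arc-dV-pV {var} i)) (π-arc (arc-dV-pV {var} j))

    ι∘π-injᵁ : ∀ i j → map ι (to π (uV m i)) ≡ map ι (to π (uV m j)) → i ≡ j
    ι∘π-injᵁ i j = suc-injective ∘ ↑ʳ-injective m (suc i) (suc j) ∘ to-injective π
                 ∘ ι-injective-on-non-sources (π-arc (arc-pV-uV {var} i)) (π-arc (arc-pV-uV {var} j))

module _ {R} var (𝔞 : Triple R) (ι : SHom (X {R} var 𝔞) R) (isι : IsIota var 𝔞 ι) where

  private
    D = proj₁ (proj₂ 𝔞)
    U = proj₂ (proj₂ 𝔞)
    G = X {R} var 𝔞
    p = pV ∣ D ∣ ∣ U ∣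
    ι-pV  = proj₁ isι
    ι-injᴰ = proj₁ (proj₂ isι)
    ∈D    = proj₁ (proj₂ (proj₂ isι))
    ι-injᵁ = proj₁ (proj₂ (proj₂ (proj₂ isι)))
    ∈U    = proj₂ (proj₂ (proj₂ (proj₂ isι)))

  ι-InjOnDU : InjOnDU {R} var 𝔞 ι
  ι-InjOnDU = ι-injᴰ , ι-injᵁ

  α-ι-pV : α ι p ≡ 𝔞
  α-ι-pV = cong₂ _,_ ι-pV (cong₂ _,_ (⊆-antisym imgᴰ⊆D D⊆imgᴰ) (⊆-antisym imgᵁ⊆U U⊆imgᵁ))
    where
    imgᴰ⊆D : img ι (Nin G p) ⊆ D
    imgᴰ⊆D w∈ = Equivalence.from (∈D _) (img-Nin-pV⁻ {var} ι w∈)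
    D⊆imgᴰ : D ⊆ img ι (Nin G p)
    D⊆imgᴰ w∈ with Equivalence.to (∈D _) w∈
    ... | i , refl = img-Nin-pV⁺ {var} ι i
    imgᵁ⊆U : img ι (Nout G p) ⊆ U
    imgᵁ⊆U w∈ = Equivalence.from (∈U _) (img-Nout-pV⁻ {var} ι w∈)
    U⊆imgᵁ : U ⊆ img ι (Nout G p)
    U⊆imgᵁ w∈ with Equivalence.to (∈U _) w∈
    ... | j , refl = img-Nout-pV⁺ {var} ι j

  ι∘π-InjOnDU : IsEo R 𝔞 → (π : Aut G) → InjOnDU {R} var 𝔞 (ι ∘ₕ autSHom π)
  ι∘π-InjOnDU (D⊆Nin , U⊆Nout) π = ι∘π-injᴰ π , ι∘π-injᵁ π
    where
    ιdV≢ιpV : ∀ i → map ι (dV ∣ U ∣ i) ≢ map ι p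
    ιdV≢ιpV i eq = proj₁ (∈-Nin⁻ R (D⊆Nin (Equivalence.from (∈D _) (i , refl)))) (trans eq ι-pV)
    ιuV≢ιpV : ∀ j → map ι (uV ∣ D ∣ j) ≢ map ι p
    ιuV≢ιpV j eq = proj₁ (∈-Nout⁻ R (U⊆Nout (Equivalence.from (∈U _) (j , refl)))) (trans eq ι-pV)
    open Separation {R} {var} ι ι-injᴰ ι-injᵁ ιdV≢ιpV ιuV≢ιpV

Xmn-cong : ∀ {var m m′ n n′} → m ≡ m′ → n ≡ n′ → Xmn var m n ≅ Xmn var m′ n′
Xmn-cong refl refl = record
  { to = id ; from = id ; from-to = λ _ → refl ; to-from = λ _ → refl ; arc-iff = λ _ _ → refl }

lemma4 : (Dp : Digraph → Set) (R S : Digraph) (var : Variant) → Setting Dp R var →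
    (σ : SScheme Dp R S) → AlphaCompat σ →
    (E : Digraph) (lab : V E → Triple R) (ev : IsEV Dp R E lab) (pE : Dp E) →
    (i : V E) →
    (ι : SHom (X {R} var (lab i)) R) → IsIota var (lab i) ι →
    (pX : Dp (X {R} var (lab i))) →
    Strong σ →
    ((π : Aut (X {R} var (lab i))) →
       InjOnDU {R} {S} var (lab i) (ρ σ (X {R} var (lab i)) pX (ι ∘ₕ autSHom π)))
    × (X {R} var (lab i) ≅ X {S} var (α (ρ σ E pE (φ ev)) i))
-- The setting only serves to put 𝓔(R) and X(𝔞) into 𝔇', which here are the hypotheses pE and pX.
lemma4 Dp R S var _ σ compat E lab ev pE i ι isι pX strong = ρ-ι∘π-InjOnDU , X𝔞≅Xε𝔞
  where
  𝔞 = lab i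
  ζ = ρ σ _ pX ι

  ρ-ι∘π-InjOnDU : (π : Aut (X {R} var 𝔞)) → InjOnDU {R} var 𝔞 (ρ σ _ pX (ι ∘ₕ autSHom π))
  ρ-ι∘π-InjOnDU π = ρ-InjOnDU σ strong compat {R} var 𝔞 pX _ (ι∘π-InjOnDU var 𝔞 ι isι 𝔞∈Eo π)
    where
    𝔞∈Eo = Equivalence.from (lab-onto ev 𝔞) (i , refl)

  ζ-InjOnDU : InjOnDU {R} var 𝔞 ζ
  ζ-InjOnDU = ρ-InjOnDU σ strong compat {R} var 𝔞 pX ι (ι-InjOnDU var 𝔞 ι isι)

  ε𝔞≡αζ : α (ρ σ E pE (φ ev)) i ≡ α ζ (pV _ _)
  ε𝔞≡αζ = compat E _ pE pX (φ ev) ι i _ (trans (α-φ ev pX ι αι≡𝔞) (sym αι≡𝔞))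
    where
    αι≡𝔞 = α-ι-pV var 𝔞 ι isι

  X𝔞≅Xε𝔞 : X {R} var 𝔞 ≅ X {S} var (α (ρ σ E pE (φ ev)) i)
  X𝔞≅Xε𝔞 = subst (λ 𝔟 → X {R} var 𝔞 ≅ X {S} var 𝔟) (sym ε𝔞≡αζ)
    (Xmn-cong {var} (sym (∣img-Nin-pV∣ {var} ζ (proj₁ ζ-InjOnDU)))
                    (sym (∣img-Nout-pV∣ {var} ζ (proj₂ ζ-InjOnDU))))
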